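{- Let $f:L\to M$ be a function between o-algebras. Then the following are equivalent: (1) $f$ is symmetrizable and preserves finite meets; (2) $f$ is an open frame homomorphism; (3) $f$ preserves all joins and meets, and the Heyting implication.
   Context: Work in intuitionistic logic without choice. A positivity predicate on a complete lattice $L$ is a unary predicate $\mathrm{Pos}$ such that: (i) $\mathrm{Pos}(x)$ and $x\le y$ imply $\mathrm{Pos}(y)$; (ii) $\mathrm{Pos}(\bigvee X)$ implies $\mathrm{Pos}(x)$ for some $x\in X$; (iii) if $\mathrm{Pos}(x)\Rightarrow x\le y$, then $x\le y$. An o-algebra is a frame $L$ with a positivity predicate such that for all $x,y$: if $\mathrm{Pos}(z\wedge x)\Rightarrow\mathrm{Pos}(z\wedge y)$ for every $z\in L$, then $x\le y$. Write $x\bowtie y$ (overlap) for $\mathrm{Pos}(x\wedge y)$. Functions $f:L\to M$, $g:M\to L$ are symmetric if $f(x)\bowtie y\iff x\bowtie g(y)$; $f$ is symmetrizable if it has a (unique) symmetric $f^\dagger$. A frame homomorphism $f$ is open if it has a left adjoint $\exists_f$ satisfying Frobenius reciprocity $\exists_f(f(x)\wedge y)=x\wedge\exists_f(y)$. -}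

module Defs where

open import Level using () renaming (suc to lsuc; zero to lzero)
open import Data.Product using (Σ; _×_; _,_)
open import Data.Empty using (⊥)
open import Data.Unit using (⊤)
open import Relation.Binary.PropositionalEquality using (_≡_)
open import Function.Bundles using (_⇔_)

Subset : Set → Set₁
Subset A = A → Set

image : {A B : Set} → (A → B) → Subset A → Subset B
image {A} f X b = Σ A (λ a → X a × (f a ≡ b))

record Frame : Set₁ where
  field
    Carrier : Set
    _≤_     : Carrier → Carrier → Set
    ≤-refl  : ∀ {x} → x ≤ x
    ≤-trans : ∀ {x y z} → x ≤ y → y ≤ z → x ≤ z
    ≤-antisym : ∀ {x y} → x ≤ y → y ≤ x → x ≡ y
    ⋁       : Subset Carrier → Carrier
    ⋁-upper : ∀ (X : Subset Carrier) {x} → X x → x ≤ ⋁ X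
    ⋁-least : ∀ (X : Subset Carrier) {y} → (∀ {x} → X x → x ≤ y) → ⋁ X ≤ y
    _∧_     : Carrier → Carrier → Carrier
    ∧-lower₁ : ∀ {x y} → (x ∧ y) ≤ x
    ∧-lower₂ : ∀ {x y} → (x ∧ y) ≤ y
    ∧-greatest : ∀ {x y z} → z ≤ x → z ≤ y → z ≤ (x ∧ y)
    distrib : ∀ x (X : Subset Carrier) → (x ∧ ⋁ X) ≡ ⋁ (image (x ∧_) X)

  infix 4 _≤_
  infixr 7 _∧_

  ⊤ₗ : Carrier
  ⊤ₗ = ⋁ (λ _ → ⊤)

  ⋀ : Subset Carrier → Carrier
  ⋀ X = ⋁ (λ z → ∀ {x} → X x → z ≤ x)

  _⇒_ : Carrier → Carrier → Carrier
  x ⇒ y = ⋁ (λ z → z ∧ x ≤ y)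

record IsPositivity (L : Frame) (Pos : Frame.Carrier L → Set) : Set₁ where
  open Frame L
  field
    pos-mono  : ∀ {x y} → Pos x → x ≤ y → Pos y
    pos-join  : ∀ (X : Subset Carrier) → Pos (⋁ X) → Σ Carrier (λ x → X x × Pos x)
    pos-stable : ∀ {x y} → (Pos x → x ≤ y) → x ≤ y

record OAlgebra : Set₁ where
  field
    frame : Frame
  open Frame frame public
  field
    Pos : Carrier → Set
    isPositivity : IsPositivity frame Pos
    pos-sep : ∀ {x y} → (∀ z → Pos (z ∧ x) → Pos (z ∧ y)) → x ≤ y

  _⋈_ : Carrier → Carrier → Set
  x ⋈ y = Pos (x ∧ y)

module _ (L M : OAlgebra) where
  private
    module L = OAlgebra L
    module M = OAlgebra M

  Symmetric : (L.Carrier → M.Carrier) → (M.Carrier → L.Carrier) → Set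
  Symmetric f g = ∀ x y → (f x M.⋈ y) ⇔ (x L.⋈ g y)

  Symmetrizable : (L.Carrier → M.Carrier) → Set
  Symmetrizable f = Σ (M.Carrier → L.Carrier) (Symmetric f)

  PreservesTop : (L.Carrier → M.Carrier) → Set
  PreservesTop f = f L.⊤ₗ ≡ M.⊤ₗ

  PreservesBinMeets : (L.Carrier → M.Carrier) → Set
  PreservesBinMeets f = ∀ x y → f (x L.∧ y) ≡ (f x M.∧ f y)

  PreservesFiniteMeets : (L.Carrier → M.Carrier) → Set
  PreservesFiniteMeets f = PreservesTop f × PreservesBinMeets f

  PreservesJoins : (L.Carrier → M.Carrier) → Set₁
  PreservesJoins f = ∀ (X : Subset L.Carrier) → f (L.⋁ X) ≡ M.⋁ (image f X)

  PreservesMeets : (L.Carrier → M.Carrier) → Set₁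
  PreservesMeets f = ∀ (X : Subset L.Carrier) → f (L.⋀ X) ≡ M.⋀ (image f X)

  PreservesImplication : (L.Carrier → M.Carrier) → Set
  PreservesImplication f = ∀ x y → f (x L.⇒ y) ≡ (f x M.⇒ f y)

  IsFrameHom : (L.Carrier → M.Carrier) → Set₁
  IsFrameHom f = PreservesFiniteMeets f × PreservesJoins f

  LeftAdjoint : (M.Carrier → L.Carrier) → (L.Carrier → M.Carrier) → Set
  LeftAdjoint e f = ∀ y x → (e y L.≤ x) ⇔ (y M.≤ f x)

  Frobenius : (M.Carrier → L.Carrier) → (L.Carrier → M.Carrier) → Set
  Frobenius e f = ∀ x y → e (f x M.∧ y) ≡ (x L.∧ e y)

  IsOpenFrameHom : (L.Carrier → M.Carrier) → Set₁
  IsOpenFrameHom f =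
    IsFrameHom f × Σ (M.Carrier → L.Carrier) (λ e → LeftAdjoint e f × Frobenius e f)

-- In an o-algebra x ≡ y as soon as z ⋈ x ⇔ z ⋈ y for all z, so (1) ⇒ (2) is a
-- sequence of overlap equivalences: a symmetric pair f, g makes f preserve
-- joins and g satisfy Frobenius reciprocity; with finite meets g ⊣ f.  For
-- (2) ⇒ (1), the left adjoint e of an open f preserves and reflects
-- positivity, which with Frobenius is the symmetry f x ⋈ y ⇔ x ⋈ e y.
-- (2) ⇔ (3) is frame theory: right adjoints preserve meets, Frobenius is
-- equivalent to preserving implication, and a meet-preserving map has the
-- left adjoint y ↦ ⋀{x | y ≤ f x}.
module Submission where

open import Level using (0ℓ)
open import Defs
open import Data.Product using (_×_; _,_; Σ)
open import Data.Sum using (_⊎_; inj₁; inj₂)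
open import Data.Empty using (⊥)
open import Data.Unit using (tt)
open import Relation.Binary.PropositionalEquality using (_≡_; refl; sym; trans; cong; subst)
open import Function.Bundles using (_⇔_; mk⇔; Equivalence)
open import Function.Construct.Identity using (⇔-id)
open import Function.Construct.Symmetry using (⇔-sym)
open import Function.Properties.Equivalence using (⇔-setoid)
import Relation.Binary.Reasoning.Setoid as ⇔-Reasoning

open Equivalence using (to; from)

≡⇒⇔ : {A B : Set} → A ≡ B → A ⇔ B
≡⇒⇔ {A} refl = ⇔-id A

∃∈ : {A : Set} → Subset A → (A → Set) → Set
∃∈ {A} X P = Σ A (λ x → X x × P x)

∃∈-cong : {A : Set} {X : Subset A} {P Q : A → Set} →
          (∀ {x} → P x ⇔ Q x) → ∃∈ X P ⇔ ∃∈ X Q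
∃∈-cong P⇔Q = mk⇔ (λ { (x , Xx , Px) → x , Xx , to P⇔Q Px })
                  (λ { (x , Xx , Qx) → x , Xx , from P⇔Q Qx })

∃∈-image : {A B : Set} {X : Subset A} {P : B → Set} (f : A → B) →
           ∃∈ X (λ x → P (f x)) ⇔ ∃∈ (image f X) P
∃∈-image f = mk⇔ (λ { (x , Xx , Pfx) → f x , (x , Xx , refl) , Pfx })
                 (λ { (_ , (x , Xx , refl) , Pfx) → x , Xx , Pfx })

module FrameFacts (F : Frame) where
  open Frame F

  ≡⇒≤ : ∀ {x y} → x ≡ y → x ≤ y
  ≡⇒≤ refl = ≤-refl

  ∧-comm : ∀ {x y} → x ∧ y ≤ y ∧ x
  ∧-comm = ∧-greatest ∧-lower₂ ∧-lower₁

  ∧-mono : ∀ {x x' y y'} → x ≤ x' → y ≤ y' → x ∧ y ≤ x' ∧ y'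
  ∧-mono p q = ∧-greatest (≤-trans ∧-lower₁ p) (≤-trans ∧-lower₂ q)

  ∧-assocˡ : ∀ {x y z} → (x ∧ y) ∧ z ≤ x ∧ (y ∧ z)
  ∧-assocˡ = ∧-greatest (≤-trans ∧-lower₁ ∧-lower₁) (∧-mono ∧-lower₂ ≤-refl)

  ∧-assocʳ : ∀ {x y z} → x ∧ (y ∧ z) ≤ (x ∧ y) ∧ z
  ∧-assocʳ = ∧-greatest (∧-mono ≤-refl ∧-lower₁) (≤-trans ∧-lower₂ ∧-lower₂)

  ⊤-greatest : ∀ {x} → x ≤ ⊤ₗ
  ⊤-greatest = ⋁-upper _ tt

  ⋀-lower : ∀ (X : Subset Carrier) {x} → X x → ⋀ X ≤ x
  ⋀-lower X Xx = ⋁-least _ (λ z≤X → z≤X Xx)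

  ⋀-greatest : ∀ (X : Subset Carrier) {z} → (∀ {x} → X x → z ≤ x) → z ≤ ⋀ X
  ⋀-greatest X z≤X = ⋁-upper _ (λ {x} → z≤X {x})

  ⇒-intro : ∀ {x y z} → z ∧ x ≤ y → z ≤ x ⇒ y
  ⇒-intro = ⋁-upper _

  -- Modus ponens; this is where frame distributivity enters.
  ⇒-elim : ∀ {x y} → (x ⇒ y) ∧ x ≤ y
  ⇒-elim {x} {y} =
    ≤-trans ∧-comm (≤-trans (≡⇒≤ (distrib x _))
      (⋁-least _ (λ { (z , z∧x≤y , refl) → ≤-trans ∧-comm z∧x≤y })))

module OAlgebraFacts (L : OAlgebra) where
  open OAlgebra L public
  open IsPositivity isPositivity public
  open FrameFacts frame public

  ⋈-comm : ∀ {x y} → x ⋈ y → y ⋈ x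
  ⋈-comm p = pos-mono p ∧-comm

  ⋈-sym : ∀ {x y} → x ⋈ y ⇔ y ⋈ x
  ⋈-sym = mk⇔ ⋈-comm ⋈-comm

  ⋈-monoˡ : ∀ {x x' y} → x ≤ x' → x ⋈ y → x' ⋈ y
  ⋈-monoˡ le p = pos-mono p (∧-mono le ≤-refl)

  ⋈-monoʳ : ∀ {x y y'} → y ≤ y' → x ⋈ y → x ⋈ y'
  ⋈-monoʳ le p = pos-mono p (∧-mono ≤-refl le)

  ⋈-assoc : ∀ {x y z} → (x ∧ y) ⋈ z ⇔ x ⋈ (y ∧ z)
  ⋈-assoc = mk⇔ (λ p → pos-mono p ∧-assocˡ) (λ p → pos-mono p ∧-assocʳ)

  ⋈-congˡ : ∀ {x x' y} → x ≡ x' → x ⋈ y ⇔ x' ⋈ y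
  ⋈-congˡ eq = ≡⇒⇔ (cong (_⋈ _) eq)

  pos⇔⋈⊤ : ∀ {x} → Pos x ⇔ ⊤ₗ ⋈ x
  pos⇔⋈⊤ = mk⇔ (λ p → pos-mono p (∧-greatest ⊤-greatest ≤-refl))
               (λ p → pos-mono p ∧-lower₂)

  -- A join overlaps z iff one of its members does (frame distributivity
  -- together with the join axiom of positivity).
  ⋈-⋁ : ∀ X {z} → ⋁ X ⋈ z ⇔ ∃∈ X (_⋈ z)
  ⋈-⋁ X {z} = mk⇔ split (λ { (x , Xx , x⋈z) → ⋈-monoˡ (⋁-upper X Xx) x⋈z })
    where
    split : ⋁ X ⋈ z → ∃∈ X (_⋈ z)
    split p with pos-join _ (subst Pos (distrib z X) (⋈-comm p))
    ... | _ , (x , Xx , refl) , z⋈x = x , Xx , ⋈-comm z⋈x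

  ≡-by-overlap : ∀ {x y} → (∀ z → z ⋈ x ⇔ z ⋈ y) → x ≡ y
  ≡-by-overlap h = ≤-antisym (pos-sep (λ z → to (h z))) (pos-sep (λ z → from (h z)))

  -- The positive part of x: the join of {x} restricted to the case Pos x.
  -- By the stability axiom every element lies below its positive part.
  positive-part : Carrier → Subset Carrier
  positive-part x w = (w ≡ x) × Pos x

  ≤-positive-part : ∀ {x} → x ≤ ⋁ (positive-part x)
  ≤-positive-part = pos-stable (λ p → ⋁-upper _ (refl , p))

Monotone : (A B : OAlgebra) → (OAlgebra.Carrier A → OAlgebra.Carrier B) → Set
Monotone A B h = ∀ {x y} → x A.≤ y → h x B.≤ h y
  where
  module A = OAlgebra A
  module B = OAlgebra B

module MapFacts (A B : OAlgebra) where
  private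
    module A = OAlgebraFacts A
    module B = OAlgebraFacts B

  -- x ≤ y means ⋁{x, y} = y, so join-preserving maps are monotone.
  joins⇒monotone : ∀ {h} → PreservesJoins A B h → Monotone A B h
  joins⇒monotone {h} preserves {x} {y} x≤y =
    B.≤-trans (B.⋁-upper (image h pair) (x , inj₁ refl , refl))
              (B.≡⇒≤ (trans (sym (preserves pair)) (cong h ⋁pair≡y)))
    where
    pair : Subset A.Carrier
    pair w = (w ≡ x) ⊎ (w ≡ y)
    ⋁pair≡y : A.⋁ pair ≡ y
    ⋁pair≡y = A.≤-antisym (A.⋁-least pair λ { (inj₁ refl) → x≤y ; (inj₂ refl) → A.≤-refl })
                          (A.⋁-upper pair (inj₂ refl))

  -- A monotone map sending joins below joins reflects positivity: if h x is
  -- positive, so is h of the positive part of x, hence some member of it.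
  subjoins⇒reflects-pos : ∀ {h} → Monotone A B h →
    (∀ S → h (A.⋁ S) B.≤ B.⋁ (image h S)) → ∀ {x} → B.Pos (h x) → A.Pos x
  subjoins⇒reflects-pos mono subjoins p
    with B.pos-join _ (B.pos-mono p (B.≤-trans (mono A.≤-positive-part) (subjoins _)))
  ... | _ , (_ , (_ , Px) , _) , _ = Px

  -- A monotone map preserving all meets preserves ⊤ = ⋀∅ and x ∧ y = ⋀{x, y}.
  meets⇒finite-meets : ∀ {h} → Monotone A B h → PreservesMeets A B h → PreservesFiniteMeets A B h
  meets⇒finite-meets {h} mono preserves = top , binary
    where
    top : PreservesTop A B h
    top = B.≤-antisym B.⊤-greatest
      (B.≤-trans (B.⋀-greatest (image h (λ _ → ⊥)) λ { (_ , () , _) })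
                 (B.≤-trans (B.≡⇒≤ (sym (preserves _))) (mono A.⊤-greatest)))

    binary : PreservesBinMeets A B h
    binary x y = B.≤-antisym
      (B.∧-greatest (mono A.∧-lower₁) (mono A.∧-lower₂))
      (B.≤-trans (B.⋀-greatest (image h pair)
                   λ { (_ , inj₁ refl , refl) → B.∧-lower₁ ; (_ , inj₂ refl , refl) → B.∧-lower₂ })
        (B.≤-trans (B.≡⇒≤ (sym (preserves pair)))
          (mono (A.∧-greatest (A.⋀-lower pair (inj₁ refl)) (A.⋀-lower pair (inj₂ refl))))))
      where
      pair : Subset A.Carrier
      pair w = (w ≡ x) ⊎ (w ≡ y)

  meets⇒left-adjoint : ∀ {h} → Monotone A B h → PreservesMeets A B h →
                       Σ (B.Carrier → A.Carrier) (λ e → LeftAdjoint A B e h)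
  meets⇒left-adjoint {h} mono preserves =
    e , λ y x → mk⇔ (λ ey≤x → B.≤-trans unit (mono ey≤x)) (A.⋀-lower _)
    where
    e : B.Carrier → A.Carrier
    e y = A.⋀ (λ x → y B.≤ h x)
    unit : ∀ {y} → y B.≤ h (e y)
    unit = B.≤-trans (B.⋀-greatest _ λ { (_ , y≤hx , refl) → y≤hx })
                     (B.≡⇒≤ (sym (preserves _)))

  unit-counit⇒adjoint : ∀ {h e} → Monotone A B h → Monotone B A e →
    (∀ {y} → y B.≤ h (e y)) → (∀ {x} → e (h x) A.≤ x) → LeftAdjoint A B e h
  unit-counit⇒adjoint h-mono e-mono unit counit y x =
    mk⇔ (λ ey≤x → B.≤-trans unit (h-mono ey≤x))
        (λ y≤hx → A.≤-trans (e-mono y≤hx) counit)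

module Adjunction (L M : OAlgebra) (f : OAlgebra.Carrier L → OAlgebra.Carrier M)
                  (e : OAlgebra.Carrier M → OAlgebra.Carrier L) (adj : LeftAdjoint L M e f) where
  private
    module L = OAlgebraFacts L
    module M = OAlgebraFacts M
  open MapFacts

  unit : ∀ {y} → y M.≤ f (e y)
  unit {y} = to (adj y (e y)) L.≤-refl

  counit : ∀ {x} → e (f x) L.≤ x
  counit {x} = from (adj (f x) x) M.≤-refl

  f-monotone : Monotone L M f
  f-monotone x≤x' = to (adj _ _) (L.≤-trans counit x≤x')

  e-monotone : Monotone M L e
  e-monotone y≤y' = from (adj _ _) (M.≤-trans y≤y' unit)

  -- The left adjoint preserves joins (we only need one inequality).
  e-subjoins : ∀ S → e (M.⋁ S) L.≤ L.⋁ (image e S)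
  e-subjoins S = from (adj _ _) (M.⋁-least S λ Sy → to (adj _ _) (L.⋁-upper _ (_ , Sy , refl)))

  f-meets : PreservesMeets L M f
  f-meets X = M.≤-antisym
    (M.⋀-greatest _ λ { (_ , Xx , refl) → f-monotone (L.⋀-lower X Xx) })
    (to (adj _ _) (L.⋀-greatest X λ Xx → from (adj _ _) (M.⋀-lower _ (_ , Xx , refl))))

  f-∧ : ∀ {x x'} → f x M.∧ f x' M.≤ f (x L.∧ x')
  f-∧ = to (adj _ _) (L.∧-greatest (L.≤-trans (e-monotone M.∧-lower₁) counit)
                                   (L.≤-trans (e-monotone M.∧-lower₂) counit))

  -- If f preserves joins, then e preserves and reflects positivity: both maps
  -- reflect it, and y ≤ f (e y).
  pos-e⇔pos : PreservesJoins L M f → ∀ {y} → L.Pos (e y) ⇔ M.Pos y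
  pos-e⇔pos f-joins = mk⇔
    (subjoins⇒reflects-pos M L e-monotone e-subjoins)
    (λ p → subjoins⇒reflects-pos L M f-monotone (λ S → M.≡⇒≤ (f-joins S))
                                  (M.pos-mono p unit))

  frobenius⇒implication : Frobenius L M e f → PreservesImplication L M f
  frobenius⇒implication frob x y = M.≤-antisym
    (M.⇒-intro (M.≤-trans f-∧ (f-monotone L.⇒-elim)))
    (to (adj _ _) (L.⇒-intro (L.≤-trans L.∧-comm
      (L.≤-trans (L.≡⇒≤ (sym (frob x _))) (from (adj _ _) (M.≤-trans M.∧-comm M.⇒-elim))))))

  -- Conversely, if f preserves implication then Frobenius holds:
  -- e y ≤ x ⇒ e (f x ∧ y) because y ≤ f x ⇒ f (e (f x ∧ y)).
  implication⇒frobenius : PreservesImplication L M f → Frobenius L M e f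
  implication⇒frobenius f-⇒ x y = L.≤-antisym
    (L.∧-greatest (from (adj _ _) M.∧-lower₁) (e-monotone M.∧-lower₂))
    (L.≤-trans L.∧-comm (L.≤-trans (L.∧-mono ey≤x⇒c L.≤-refl) L.⇒-elim))
    where
    c : L.Carrier
    c = e (f x M.∧ y)
    ey≤x⇒c : e y L.≤ (x L.⇒ c)
    ey≤x⇒c = from (adj _ _) (M.≤-trans (M.⇒-intro (M.≤-trans M.∧-comm unit))
                                       (M.≡⇒≤ (sym (f-⇒ x c))))

  open⇒symmetric : PreservesJoins L M f → Frobenius L M e f → Symmetric L M f e
  open⇒symmetric f-joins frob x y = begin
    f x M.⋈ y             ≈⟨ ⇔-sym (pos-e⇔pos f-joins) ⟩
    L.Pos (e (f x M.∧ y)) ≈⟨ ≡⇒⇔ (cong L.Pos (frob x y)) ⟩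
    x L.⋈ e y             ∎
    where open ⇔-Reasoning (⇔-setoid 0ℓ)

module Symmetrization (L M : OAlgebra) (f : OAlgebra.Carrier L → OAlgebra.Carrier M)
                      (g : OAlgebra.Carrier M → OAlgebra.Carrier L) (sy : Symmetric L M f g) where
  private
    module L = OAlgebraFacts L
    module M = OAlgebraFacts M
  open MapFacts
  open ⇔-Reasoning (⇔-setoid 0ℓ)

  f-joins : PreservesJoins L M f
  f-joins X = M.≡-by-overlap λ z → begin
    z M.⋈ f (L.⋁ X)                ≈⟨ M.⋈-sym ⟩
    f (L.⋁ X) M.⋈ z                ≈⟨ sy _ z ⟩
    L.⋁ X L.⋈ g z                  ≈⟨ L.⋈-⋁ X ⟩
    ∃∈ X (L._⋈ g z)                ≈⟨ ∃∈-cong (⇔-sym (sy _ z)) ⟩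
    ∃∈ X (λ x → f x M.⋈ z)         ≈⟨ ∃∈-image f ⟩
    ∃∈ (image f X) (M._⋈ z)        ≈⟨ ⇔-sym (M.⋈-⋁ (image f X)) ⟩
    M.⋁ (image f X) M.⋈ z          ≈⟨ M.⋈-sym ⟩
    z M.⋈ M.⋁ (image f X)          ∎

  f-monotone : Monotone L M f
  f-monotone = joins⇒monotone L M f-joins

  g-monotone : Monotone M L g
  g-monotone y≤y' = L.pos-sep λ z z⋈gy →
    to (sy z _) (M.⋈-monoʳ y≤y' (from (sy z _) z⋈gy))

  -- If f preserves ⊤, then g preserves positivity: ⊤ ⋈ y ⇔ ⊤ ⋈ g y.
  g-pos : PreservesTop L M f → ∀ {y} → M.Pos y → L.Pos (g y)
  g-pos f-⊤ p = from L.pos⇔⋈⊤ (to (sy _ _) (subst (M._⋈ _) (sym f-⊤) (to M.pos⇔⋈⊤ p)))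

  g-frobenius : PreservesBinMeets L M f → Frobenius L M g f
  g-frobenius f-∧ x y = L.≡-by-overlap λ z → begin
    z L.⋈ g (f x M.∧ y)     ≈⟨ ⇔-sym (sy z _) ⟩
    f z M.⋈ (f x M.∧ y)     ≈⟨ ⇔-sym M.⋈-assoc ⟩
    (f z M.∧ f x) M.⋈ y     ≈⟨ M.⋈-congˡ (sym (f-∧ z x)) ⟩
    f (z L.∧ x) M.⋈ y       ≈⟨ sy _ y ⟩
    (z L.∧ x) L.⋈ g y       ≈⟨ L.⋈-assoc ⟩
    z L.⋈ (x L.∧ g y)       ∎

  -- The counit
  -- g (f x) = g (f x ∧ ⊤) = x ∧ g ⊤ ≤ x is Frobenius; the unit y ≤ f (g y)
  -- holds since z ⋈ y makes g (z ∧ y) positive, hence f (g (z ∧ y)) ⋈ (z ∧ y).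
  g⊣f : PreservesFiniteMeets L M f → LeftAdjoint L M g f
  g⊣f (f-⊤ , f-∧) = unit-counit⇒adjoint L M f-monotone g-monotone unit counit
    where
    counit : ∀ {x} → g (f x) L.≤ x
    counit {x} = L.≤-trans (g-monotone (M.∧-greatest M.≤-refl M.⊤-greatest))
                           (L.≤-trans (L.≡⇒≤ (g-frobenius f-∧ x M.⊤ₗ)) L.∧-lower₁)

    unit : ∀ {y} → y M.≤ f (g y)
    unit = M.pos-sep λ z z⋈y →
      let w⋈w = L.pos-mono (g-pos f-⊤ z⋈y) (L.∧-greatest L.≤-refl L.≤-refl)
      in M.⋈-comm (M.⋈-monoʳ M.∧-lower₁
           (M.⋈-monoˡ (f-monotone (g-monotone M.∧-lower₂)) (from (sy _ _) w⋈w)))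

module _ (L M : OAlgebra) (f : OAlgebra.Carrier L → OAlgebra.Carrier M) where

  PreservesAll : Set₁
  PreservesAll = PreservesJoins L M f × PreservesMeets L M f × PreservesImplication L M f

  symmetrizable⇒open : Symmetrizable L M f × PreservesFiniteMeets L M f → IsOpenFrameHom L M f
  symmetrizable⇒open ((g , sy) , finite-meets@(_ , f-∧)) =
    (finite-meets , f-joins) , g , g⊣f finite-meets , g-frobenius f-∧
    where open Symmetrization L M f g sy

  open⇒symmetrizable : IsOpenFrameHom L M f → Symmetrizable L M f × PreservesFiniteMeets L M f
  open⇒symmetrizable ((finite-meets , f-joins) , e , adj , frob) =
    (e , open⇒symmetric f-joins frob) , finite-meets
    where open Adjunction L M f e adj

  open⇒preserves-all : IsOpenFrameHom L M f → PreservesAll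
  open⇒preserves-all ((_ , f-joins) , e , adj , frob) =
    f-joins , f-meets , frobenius⇒implication frob
    where open Adjunction L M f e adj

  preserves-all⇒open : PreservesAll → IsOpenFrameHom L M f
  preserves-all⇒open (f-joins , f-meets , f-⇒) =
    open-from-adjoint (meets⇒left-adjoint f-monotone f-meets)
    where
    open MapFacts L M
    f-monotone : Monotone L M f
    f-monotone = joins⇒monotone f-joins
    open-from-adjoint : Σ (OAlgebra.Carrier M → OAlgebra.Carrier L) (λ e → LeftAdjoint L M e f) →
                        IsOpenFrameHom L M f
    open-from-adjoint (e , adj) =
      (meets⇒finite-meets f-monotone f-meets , f-joins) , e , adj , implication⇒frobenius f-⇒
      where open Adjunction L M f e adj using (implication⇒frobenius)

proposition5p2 : (L M : OAlgebra) (f : OAlgebra.Carrier L → OAlgebra.Carrier M) →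
    ((Symmetrizable L M f × PreservesFiniteMeets L M f) ⇔ IsOpenFrameHom L M f)
    × (IsOpenFrameHom L M f ⇔ (PreservesJoins L M f × PreservesMeets L M f × PreservesImplication L M f))
proposition5p2 L M f =
  mk⇔ (symmetrizable⇒open L M f) (open⇒symmetrizable L M f) ,
  mk⇔ (open⇒preserves-all L M f) (preserves-all⇒open L M f)
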